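{- Let $G=(V,E)$ be a graph and $\pi$ an unstable partition of $V$. Then $\operatorname{cost}(\pi)=\min_{(R,S)}\big(\operatorname{cost}(\pi(R,S))+\operatorname{cost}(R,S)\big)$, where the minimum is taken over all effective elementary refining operations $(R,S)$ that can be applied to $\pi$.
   Context: $G$ is an undirected graph. $\pi$ is stable if for all $u,v$ in a common cell and every cell $R\in\pi$, $|N(u)\cap R|=|N(v)\cap R|$. A set is $\pi$-closed if it is a union of cells. For $\pi$-closed $R,S$, the refining operation $(R,S)$ produces $\pi(R,S)$: cells of $\pi$ disjoint from $S$ are kept, and $u,v\in S$ share a cell of $\pi(R,S)$ iff they share a cell of $\pi$ and $|N(u)\cap R'|=|N(v)\cap R'|$ for all cells $R'\in\pi$ with $R'\subseteq R$. It is effective if $\pi(R,S)\ne\pi$, and elementary if both $R\in\pi$ and $S\in\pi$. $\operatorname{cost}(R,S)=|\{(u,v):uv\in E,u\in R,v\in S\}|$. $\operatorname{cost}(\pi)=0$ if $\pi$ is stable, and otherwise $\operatorname{cost}(\pi)=\min_{(R,S)}(\operatorname{cost}(\pi(R,S))+\operatorname{cost}(R,S))$ over all (not necessarily elementary) effective refining operations applicable to $\pi$. -}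

module Defs where

open import Data.Bool using (Bool; true; false; _∧_; _∨_; not; if_then_else_; T)
open import Data.Nat using (ℕ; zero; suc; _+_; _⊓_; _≡ᵇ_)
open import Data.Fin using (Fin; zero; suc)
open import Data.List using (List; []; _∷_; [_]; allFin; concatMap; foldr)
open import Relation.Binary.PropositionalEquality using (_≡_)

record Graph (n : ℕ) : Set where
  field
    adj         : Fin n → Fin n → Bool
    symmetric   : ∀ u v → adj u v ≡ adj v u
    irreflexive : ∀ v → adj v v ≡ false
open Graph public

VSet : ℕ → Set
VSet n = Fin n → Bool

-- A partition of V is given by its "same cell" relation (an equivalence relation).
PRel : ℕ → Set
PRel n = Fin n → Fin n → Bool

record IsPartition {n : ℕ} (π : PRel n) : Set where
  field
    reflexive  : ∀ u → T (π u u)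
    sym        : ∀ u v → T (π u v) → T (π v u)
    transitive : ∀ u v w → T (π u v) → T (π v w) → T (π u w)

beq : Bool → Bool → Bool
beq a b = (a ∧ b) ∨ (not a ∧ not b)

allV : ∀ {n} → (Fin n → Bool) → Bool
allV {n} p = foldr (λ x b → p x ∧ b) true (allFin n)

anyV : ∀ {n} → (Fin n → Bool) → Bool
anyV {n} p = foldr (λ x b → p x ∨ b) false (allFin n)

count : ∀ {n} → (Fin n → Bool) → ℕ
count {n} p = foldr (λ x k → if p x then suc k else k) 0 (allFin n)

sumV : ∀ {n} → (Fin n → ℕ) → ℕ
sumV {n} f = foldr (λ x k → f x + k) 0 (allFin n)

subset? : ∀ {n} → VSet n → VSet n → Bool
subset? R S = allV (λ x → not (R x) ∨ S x)

cell : ∀ {n} → PRel n → Fin n → VSet n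
cell π w = π w

nbrs : ∀ {n} → Graph n → Fin n → VSet n → ℕ
nbrs G u R = count (λ x → adj G u x ∧ R x)

stable? : ∀ {n} → Graph n → PRel n → Bool
stable? G π = allV λ u → allV λ v → not (π u v) ∨
  allV (λ w → nbrs G u (cell π w) ≡ᵇ nbrs G v (cell π w))

Stable : ∀ {n} → Graph n → PRel n → Set
Stable G π = T (stable? G π)

closed? : ∀ {n} → PRel n → VSet n → Bool
closed? π R = allV λ u → allV λ v → not (π u v) ∨ beq (R u) (R v)

isCell? : ∀ {n} → PRel n → VSet n → Bool
isCell? π R = anyV λ w → allV λ x → beq (R x) (cell π w x)

refine : ∀ {n} → Graph n → PRel n → VSet n → VSet n → PRel n
refine G π R S u v = π u v ∧ (not (S u ∧ S v) ∨
  allV (λ w → not (subset? (cell π w) R) ∨ (nbrs G u (cell π w) ≡ᵇ nbrs G v (cell π w))))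

samePartition? : ∀ {n} → PRel n → PRel n → Bool
samePartition? π ρ = allV λ u → allV λ v → beq (π u v) (ρ u v)

effective? : ∀ {n} → Graph n → PRel n → VSet n → VSet n → Bool
effective? G π R S = not (samePartition? (refine G π R S) π)

opCost : ∀ {n} → Graph n → VSet n → VSet n → ℕ
opCost G R S = sumV λ u → count λ v → adj G u v ∧ R u ∧ S v

allSubsets : ∀ n → List (VSet n)
allSubsets zero = [ (λ ()) ] 
allSubsets (suc n) = concatMap (λ R → ext false R ∷ ext true R ∷ []) (allSubsets n)
  where
    ext : Bool → VSet n → VSet (suc n)
    ext b R zero = b
    ext b R (suc i) = R i

minL : List ℕ → ℕ
minL [] = 0
minL (x ∷ xs) = foldr _⊓_ x xs

costF : ∀ {n} → Graph n → ℕ → PRel n → ℕ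
costF G zero π = 0
costF {n} G (suc k) π =
  if stable? G π then 0 else
  minL (concatMap (λ R → concatMap (λ S →
          if closed? π R ∧ closed? π S ∧ effective? G π R S
          then [ costF G k (refine G π R S) + opCost G R S ]
          else []) (allSubsets n)) (allSubsets n))

-- Every effective refinement strictly increases the number of cells (≤ n),
-- so fuel n+1 suffices: this is the recursively defined cost(π).
cost : ∀ {n} → Graph n → PRel n → ℕ
cost {n} G π = costF G (suc n) π

Elementary : ∀ {n} → PRel n → VSet n → VSet n → Set
Elementary π R S = T (isCell? π R ∧ isCell? π S)

Effective : ∀ {n} → Graph n → PRel n → VSet n → VSet n → Set
Effective G π R S = T (effective? G π R S)

module Submission where

open import Defs
open import Data.Bool using (Bool; true; false; _∧_; _∨_; not; if_then_else_; T)
open import Data.Bool.Properties using (∧-assoc; ∧-zeroʳ; ∧-identityʳ; T-∧)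
open import Data.Empty using (⊥-elim)
open import Data.Fin using (Fin; zero; suc; toℕ)
open import Data.Fin.Properties using (toℕ-injective; any?)
open import Data.List using (List; []; _∷_; [_]; allFin; concatMap; foldr; length)
open import Data.List.Properties using (concatMap-cong; length-tabulate; foldr-preservesᵒ)
open import Data.List.Membership.Propositional using (_∈_; find; lose)
open import Data.List.Membership.Propositional.Properties
  using (∈-allFin; foldr-selective; ∈-concatMap⁺; ∈-concatMap⁻)
open import Data.List.Relation.Unary.Any using (Any; here; there)
import Data.List.Relation.Unary.Any as Any
open import Data.List.Relation.Unary.Any.Properties using (concatMap⁺)
open import Data.Nat using (ℕ; zero; suc; _+_; _≤_; _<_; _⊓_; _≡ᵇ_; _<ᵇ_; z≤n; s≤s)
open import Data.Nat.Properties
  using ( +-suc; +-comm; +-identityʳ; +-monoʳ-≤; +-monoˡ-≤; m≤m+n; m≤n⇒m≤1+n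
        ; ≤-refl; ≤-reflexive; ≤-trans; ≤-antisym; ≤-pred; <⇒≱; <-cmp
        ; ⊓-sel; m≤n⇒m⊓o≤n; m≤n⇒o⊓m≤n; ≡ᵇ⇒≡; ≡⇒≡ᵇ; <ᵇ⇒<; <⇒<ᵇ
        ; +-commutativeSemigroup; module ≤-Reasoning )
open import Data.Nat.Tactic.RingSolver using (solve-∀)
open import Algebra.Properties.CommutativeSemigroup +-commutativeSemigroup using (interchange)
open import Data.Product using (Σ; ∃; _×_; _,_; proj₁; proj₂)
open import Data.Sum using (_⊎_; inj₁; inj₂)
open import Data.Unit using (tt)
open import Function.Bundles using (Equivalence)
open import Relation.Nullary using (¬_; Dec; yes; no)
open import Relation.Binary.Definitions using (tri<; tri≈; tri>)
open import Relation.Nullary.Decidable using (T?)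
open import Relation.Binary.PropositionalEquality
  using (_≡_; refl; sym; trans; cong; cong₂; subst; module ≡-Reasoning)

-- Any elementary effective (R,S) bounds cost(π) by the recursion.  For the
-- converse take an optimal admissible (A,B).  It splits two vertices u, v of a
-- cell, so u ∈ B and some cell R ⊆ A separates u from v; let S be u's cell.
-- The three operations (R,S), (R, B∖S), (A∖R, B) together cost exactly
-- cost(A,B) and end in a partition finer than π(A,B).  Cost is monotone on
-- partitions lying between π and its stable refinements (the range refining
-- operations never leave), so performing (R,S) first is no worse than (A,B).

∧-elim : ∀ {a b} → T (a ∧ b) → T a × T b
∧-elim = Equivalence.to T-∧

∧-intro : ∀ {a b} → T a → T b → T (a ∧ b)
∧-intro ta tb = Equivalence.from T-∧ (ta , tb)

not-intro : ∀ {a} → ¬ T a → T (not a)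
not-intro {false} _ = tt
not-intro {true}  h = h tt

not-elim : ∀ {a} → T (not a) → ¬ T a
not-elim {false} _ ()

¬not-elim : ∀ {a} → ¬ T (not a) → T a
¬not-elim {true}  _ = tt
¬not-elim {false} h = ⊥-elim (h tt)

⇒ᵇ-elim : ∀ a b → T (not a ∨ b) → T a → T b
⇒ᵇ-elim true b h _ = h

⇒ᵇ-intro : ∀ a b → (T a → T b) → T (not a ∨ b)
⇒ᵇ-intro true  b h = h tt
⇒ᵇ-intro false b h = tt

⇒ᵇ-counterexample : ∀ a b → ¬ T (not a ∨ b) → T a × ¬ T b
⇒ᵇ-counterexample true  b h = tt , h
⇒ᵇ-counterexample false b h = ⊥-elim (h tt)

beq-sound : ∀ a b → T (beq a b) → a ≡ b
beq-sound true  true  _ = refl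
beq-sound false false _ = refl

beq-complete : ∀ a b → a ≡ b → T (beq a b)
beq-complete true  _ refl = tt
beq-complete false _ refl = tt

beq-counterexample : ∀ a b → ¬ T (beq a b) → (T a × ¬ T b) ⊎ (¬ T a × T b)
beq-counterexample true  false _ = inj₁ (tt , λ ())
beq-counterexample false true  _ = inj₂ ((λ ()) , tt)
beq-counterexample true  true  h = ⊥-elim (h tt)
beq-counterexample false false h = ⊥-elim (h tt)

T-ext : ∀ {a b} → (T a → T b) → (T b → T a) → a ≡ b
T-ext {true}  {true}  _ _ = refl
T-ext {false} {false} _ _ = refl
T-ext {true}  {false} f _ = ⊥-elim (f tt)
T-ext {false} {true}  _ g = ⊥-elim (g tt)

-- Counting and summing along a list.  count p  is  countIn p (allFin n)  and
-- opCost is a sumIn, so these general list facts specialise by definition.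

module _ {A : Set} where

  countIn : (A → Bool) → List A → ℕ
  countIn p = foldr (λ x k → if p x then suc k else k) 0

  countIn-cong : (p q : A → Bool) → (∀ x → p x ≡ q x) → ∀ xs → countIn p xs ≡ countIn q xs
  countIn-cong p q h []       = refl
  countIn-cong p q h (y ∷ ys) rewrite h y = cong (λ k → if q y then suc k else k) (countIn-cong p q h ys)

  countIn-split : (p q : A → Bool) → ∀ xs →
                  countIn p xs ≡ countIn (λ x → p x ∧ q x) xs + countIn (λ x → p x ∧ not (q x)) xs
  countIn-split p q [] = refl
  countIn-split p q (y ∷ ys) with p y | q y
  ... | true  | true  = cong suc (countIn-split p q ys)
  ... | true  | false = trans (cong suc (countIn-split p q ys)) (sym (+-suc _ _))
  ... | false | _     = countIn-split p q ys

  countIn-mono : (p q : A → Bool) → (∀ x → T (p x) → T (q x)) →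
                 ∀ xs → countIn p xs ≤ countIn q xs
  countIn-mono p q h [] = z≤n
  countIn-mono p q h (y ∷ ys) with p y | q y | h y
  ... | true  | true  | _  = s≤s (countIn-mono p q h ys)
  ... | true  | false | hy = ⊥-elim (hy tt)
  ... | false | true  | _  = m≤n⇒m≤1+n (countIn-mono p q h ys)
  ... | false | false | _  = countIn-mono p q h ys

  countIn-strict : (p q : A → Bool) → (∀ x → T (p x) → T (q x)) →
                   ∀ {z} xs → z ∈ xs → T (q z) → ¬ T (p z) → countIn p xs < countIn q xs
  countIn-strict p q h (y ∷ ys) (here refl) qz ¬pz with p y | q y
  ... | true  | _     = ⊥-elim (¬pz tt)
  ... | false | true  = s≤s (countIn-mono p q h ys)
  ... | false | false = ⊥-elim qz
  countIn-strict p q h (y ∷ ys) (there z∈) qz ¬pz = on-cons (countIn-strict p q h ys z∈ qz ¬pz)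
    where
    on-cons : countIn p ys < countIn q ys → countIn p (y ∷ ys) < countIn q (y ∷ ys)
    on-cons lt with p y | q y | h y
    ... | true  | true  | _  = s≤s lt
    ... | true  | false | hy = ⊥-elim (hy tt)
    ... | false | true  | _  = m≤n⇒m≤1+n lt
    ... | false | false | _  = lt

  countIn-≤-length : (p : A → Bool) → ∀ xs → countIn p xs ≤ length xs
  countIn-≤-length p [] = z≤n
  countIn-≤-length p (y ∷ ys) with p y
  ... | true  = s≤s (countIn-≤-length p ys)
  ... | false = m≤n⇒m≤1+n (countIn-≤-length p ys)

  countIn-zero : (p : A → Bool) → (∀ x → ¬ T (p x)) → ∀ xs → countIn p xs ≡ 0
  countIn-zero p h []       = refl
  countIn-zero p h (y ∷ ys) with p y | h y
  ... | true  | hy = ⊥-elim (hy tt)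
  ... | false | _  = countIn-zero p h ys

  sumIn : (A → ℕ) → List A → ℕ
  sumIn f = foldr (λ x k → f x + k) 0

  sumIn-+ : (f g : A → ℕ) → ∀ xs → sumIn (λ x → f x + g x) xs ≡ sumIn f xs + sumIn g xs
  sumIn-+ f g []       = refl
  sumIn-+ f g (y ∷ ys) rewrite sumIn-+ f g ys = interchange (f y) (g y) (sumIn f ys) (sumIn g ys)

  sumIn-cong : (f g : A → ℕ) → (∀ x → f x ≡ g x) → ∀ xs → sumIn f xs ≡ sumIn g xs
  sumIn-cong f g h []       = refl
  sumIn-cong f g h (y ∷ ys) = cong₂ _+_ (h y) (sumIn-cong f g h ys)

minL-≤ : ∀ {x} xs → x ∈ xs → minL xs ≤ x
minL-≤ {x} (y ∷ ys) x∈ = foldr-preservesᵒ {P = _≤ x} keeps y ys (located x∈)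
  where
  keeps : ∀ a b → a ≤ x ⊎ b ≤ x → a ⊓ b ≤ x
  keeps a b (inj₁ a≤x) = m≤n⇒m⊓o≤n b a≤x
  keeps a b (inj₂ b≤x) = m≤n⇒o⊓m≤n a b≤x
  located : x ∈ y ∷ ys → y ≤ x ⊎ Any (_≤ x) ys
  located (here refl) = inj₁ ≤-refl
  located (there x∈)  = inj₂ (Any.map (λ { refl → ≤-refl }) x∈)

minL-∈ : ∀ {x} xs → x ∈ xs → minL xs ∈ xs
minL-∈ (y ∷ ys) _ with foldr-selective ⊓-sel y ys
... | inj₁ eq = here eq
... | inj₂ m  = there m

singleton-if-cong : ∀ {A : Set} {b b′} {x x′ : A} → b ≡ b′ → (T b → x ≡ x′) →
                    (if b then [ x ] else []) ≡ (if b′ then [ x′ ] else [])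
singleton-if-cong {b = true}  refl x≡x′ = cong [_] (x≡x′ tt)
singleton-if-cong {b = false} refl _    = refl

singleton-if-∈ : ∀ {A : Set} {b} {x : A} → T b → x ∈ (if b then [ x ] else [])
singleton-if-∈ {b = true} _ = here refl

module _ {n : ℕ} where

  allV-sound : (p : Fin n → Bool) → T (allV p) → ∀ x → T (p x)
  allV-sound p h x = go (allFin n) h (∈-allFin x)
    where
    go : ∀ xs → T (foldr (λ y b → p y ∧ b) true xs) → x ∈ xs → T (p x)
    go (y ∷ ys) h (here refl) = proj₁ (∧-elim h)
    go (y ∷ ys) h (there x∈) = go ys (proj₂ (∧-elim {p y} h)) x∈

  allV-complete : (p : Fin n → Bool) → (∀ x → T (p x)) → T (allV p)
  allV-complete p h = go (allFin n)
    where
    go : ∀ xs → T (foldr (λ y b → p y ∧ b) true xs)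
    go []       = tt
    go (y ∷ ys) = ∧-intro (h y) (go ys)

  allV-counterexample : (p : Fin n → Bool) → ¬ T (allV p) → ∃ λ x → ¬ T (p x)
  allV-counterexample p h = go (allFin n) h
    where
    go : ∀ xs → ¬ T (foldr (λ y b → p y ∧ b) true xs) → ∃ λ x → ¬ T (p x)
    go []       h = ⊥-elim (h tt)
    go (y ∷ ys) h with p y in eq
    ... | true  = go ys h
    ... | false = y , λ py → subst T eq py

  allV-cong : (p q : Fin n → Bool) → (∀ x → p x ≡ q x) → allV p ≡ allV q
  allV-cong p q h = go (allFin n)
    where
    go : ∀ xs → foldr (λ y b → p y ∧ b) true xs ≡ foldr (λ y b → q y ∧ b) true xs
    go []       = refl
    go (y ∷ ys) = cong₂ _∧_ (h y) (go ys)

  anyV-sound : (p : Fin n → Bool) → T (anyV p) → ∃ λ x → T (p x)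
  anyV-sound p = go (allFin n)
    where
    go : ∀ xs → T (foldr (λ y b → p y ∨ b) false xs) → ∃ λ x → T (p x)
    go (y ∷ ys) h with p y in eq
    ... | true  = y , subst T (sym eq) tt
    ... | false = go ys h

  anyV-complete : (p : Fin n → Bool) (x : Fin n) → T (p x) → T (anyV p)
  anyV-complete p x px = go (allFin n) (∈-allFin x)
    where
    go : ∀ xs → x ∈ xs → T (foldr (λ y b → p y ∨ b) false xs)
    go (y ∷ ys) x∈ with p y in eq
    ... | true = tt
    go (y ∷ ys) (here refl) | false = ⊥-elim (subst T eq px)
    go (y ∷ ys) (there x∈)  | false = go ys x∈

module _ {n : ℕ} where

  infix 4 _⊑_ _⊆_ _≐_ _≈_
  infixl 6 _∩_ _∖_

  _⊑_ : PRel n → PRel n → Set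
  ρ ⊑ σ = ∀ {u v} → T (ρ u v) → T (σ u v)

  _⊆_ : VSet n → VSet n → Set
  X ⊆ Y = ∀ {x} → T (X x) → T (Y x)

  _≐_ : VSet n → VSet n → Set
  X ≐ Y = ∀ x → X x ≡ Y x

  _≈_ : PRel n → PRel n → Set
  ρ ≈ σ = ∀ u v → ρ u v ≡ σ u v

  _∩_ : VSet n → VSet n → VSet n
  (X ∩ Y) x = X x ∧ Y x

  _∖_ : VSet n → VSet n → VSet n
  (X ∖ Y) x = X x ∧ not (Y x)

  Closed : PRel n → VSet n → Set
  Closed ρ X = ∀ {u v} → T (ρ u v) → X u ≡ X v

  closed?-sound : ∀ ρ X → T (closed? ρ X) → Closed ρ X
  closed?-sound ρ X h {u} {v} r =
    beq-sound _ _ (⇒ᵇ-elim (ρ u v) _ (allV-sound _ (allV-sound _ h u) v) r)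

  closed?-complete : ∀ ρ X → Closed ρ X → T (closed? ρ X)
  closed?-complete ρ X c = allV-complete _ λ u → allV-complete _ λ v →
    ⇒ᵇ-intro (ρ u v) _ λ r → beq-complete _ _ (c r)

  subset?-sound : ∀ X Y → T (subset? X Y) → X ⊆ Y
  subset?-sound X Y h {x} = ⇒ᵇ-elim (X x) (Y x) (allV-sound _ h x)

  subset?-complete : ∀ X Y → X ⊆ Y → T (subset? X Y)
  subset?-complete X Y h = allV-complete _ λ x → ⇒ᵇ-intro (X x) (Y x) h

  ∩-⊆ʳ : ∀ {X Y} → X ∩ Y ⊆ Y
  ∩-⊆ʳ {X} {Y} {x} h = proj₂ (∧-elim {X x} h)

  ∖-⊆ˡ : ∀ {X Y} → X ∖ Y ⊆ X
  ∖-⊆ˡ {X} {Y} {x} h = proj₁ (∧-elim {X x} h)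

  ∩-⊇ : ∀ {X Y} → Y ⊆ X → X ∩ Y ≐ Y
  ∩-⊇ {X} {Y} Y⊆X x with Y x in eq
  ... | true  = trans (∧-identityʳ (X x)) (T-ext (λ _ → tt) (λ _ → Y⊆X (subst T (sym eq) tt)))
  ... | false = ∧-zeroʳ (X x)

  closed-⊑ : ∀ {ρ σ X} → σ ⊑ ρ → Closed ρ X → Closed σ X
  closed-⊑ σ⊑ρ c r = c (σ⊑ρ r)

  closed-∩ : ∀ {ρ X Y} → Closed ρ X → Closed ρ Y → Closed ρ (X ∩ Y)
  closed-∩ cX cY r = cong₂ _∧_ (cX r) (cY r)

  closed-∖ : ∀ {ρ X Y} → Closed ρ X → Closed ρ Y → Closed ρ (X ∖ Y)
  closed-∖ cX cY r = cong₂ (λ a b → a ∧ not b) (cX r) (cY r)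

  closed?-cong : ∀ {ρ σ X Y} → ρ ≈ σ → X ≐ Y → closed? ρ X ≡ closed? σ Y
  closed?-cong ρ≈σ X≐Y = allV-cong _ _ λ u → allV-cong _ _ λ v →
    cong₂ (λ a b → not a ∨ b) (ρ≈σ u v) (cong₂ beq (X≐Y u) (X≐Y v))

  subset?-cong : ∀ {X X′ Y Y′} → X ≐ X′ → Y ≐ Y′ → subset? X Y ≡ subset? X′ Y′
  subset?-cong X≐X′ Y≐Y′ =
    allV-cong _ _ λ x → cong₂ (λ a b → not a ∨ b) (X≐X′ x) (Y≐Y′ x)

  module _ {ρ : PRel n} (P : IsPartition ρ) where
    open IsPartition P renaming (sym to ρ-sym; transitive to ρ-trans)

    cell-closed : ∀ w → Closed ρ (ρ w)
    cell-closed w {u} {v} r = T-ext (λ wu → ρ-trans w u v wu r) (λ wv → ρ-trans w v u wv (ρ-sym u v r))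

    isCell?-closed : ∀ R → T (isCell? ρ R) → Closed ρ R
    isCell?-closed R h {u} {v} r with anyV-sound _ h
    ... | w , R≐ρw = trans (same u) (trans (cell-closed w r) (sym (same v)))
      where
      same : ∀ x → R x ≡ ρ w x
      same x = beq-sound _ _ (allV-sound _ R≐ρw x)

  cell-isCell? : ∀ (ρ : PRel n) w → T (isCell? ρ (ρ w))
  cell-isCell? ρ w = anyV-complete _ w (allV-complete _ λ x → beq-complete (ρ w x) _ refl)

allSubsets-complete : ∀ m (A : VSet m) → Any (_≐ A) (allSubsets m)
allSubsets-complete zero    A = here (λ ())
allSubsets-complete (suc m) A with A zero in eq
... | false = concatMap⁺ _ (Any.map (λ B≐ → here (λ { zero → sym eq ; (suc i) → B≐ i }))
                                  (allSubsets-complete m (λ i → A (suc i))))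
... | true  = concatMap⁺ _ (Any.map (λ B≐ → there (here (λ { zero → sym eq ; (suc i) → B≐ i })))
                                  (allSubsets-complete m (λ i → A (suc i))))

-- The number of cells of a partition, counted by the least vertex of each cell.
-- It bounds the length of every chain of effective refining operations.

module _ {n : ℕ} where

  leader? : PRel n → Fin n → Bool
  leader? ρ u = not (anyV (λ w → (toℕ w <ᵇ toℕ u) ∧ ρ w u))

  cells : PRel n → ℕ
  cells ρ = count (leader? ρ)

  cells-≤ : ∀ ρ → cells ρ ≤ n
  cells-≤ ρ = subst (cells ρ ≤_) (length-tabulate (λ x → x)) (countIn-≤-length (leader? ρ) (allFin n))

  leader-⊑ : ∀ {ρ σ} → σ ⊑ ρ → ∀ {u} → T (leader? ρ u) → T (leader? σ u)
  leader-⊑ {ρ} {σ} σ⊑ρ {u} lead = not-intro λ h →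
    let w , hw = anyV-sound (λ w → (toℕ w <ᵇ toℕ u) ∧ σ w u) h
        w<u , σwu = ∧-elim {toℕ w <ᵇ toℕ u} hw
    in not-elim lead (anyV-complete (λ w → (toℕ w <ᵇ toℕ u) ∧ ρ w u) w (∧-intro w<u (σ⊑ρ σwu)))

  module _ {ρ : PRel n} (P : IsPartition ρ) where
    open IsPartition P renaming (sym to ρ-sym; transitive to ρ-trans)

    leader-exists : ∀ x → ∃ λ m → T (ρ m x) × T (leader? ρ m)
    leader-exists x = go (suc (toℕ x)) x ≤-refl
      where
      -- descend through smaller cell-mates; the bound makes the recursion structural
      go : ∀ b x → toℕ x < b → ∃ λ m → T (ρ m x) × T (leader? ρ m)
      go (suc b) x x<b with anyV (λ w → (toℕ w <ᵇ toℕ x) ∧ ρ w x) in eq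
      ... | false = x , reflexive x , subst (λ b → T (not b)) (sym eq) tt
      ... | true with anyV-sound _ (subst T (sym eq) tt)
      ... | w , hw with ∧-elim {toℕ w <ᵇ toℕ x} hw
      ... | w<x , ρwx with go b w (≤-trans (<ᵇ⇒< _ _ w<x) (≤-pred x<b))
      ... | m , ρmw , lead = m , ρ-trans m w x ρmw ρwx , lead

    leader-unique : ∀ {a b} → T (leader? ρ a) → T (leader? ρ b) → T (ρ a b) → a ≡ b
    leader-unique {a} {b} lead-a lead-b r with <-cmp (toℕ a) (toℕ b)
    ... | tri< a<b _ _ = ⊥-elim (not-elim lead-b (anyV-complete _ a (∧-intro (<⇒<ᵇ a<b) r)))
    ... | tri≈ _ a≡b _ = toℕ-injective a≡b
    ... | tri> _ _ b<a = ⊥-elim (not-elim lead-a (anyV-complete _ b (∧-intro (<⇒<ᵇ b<a) (ρ-sym a b r))))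

    cells-pos : Fin n → 0 < cells ρ
    cells-pos x = let m , _ , lead = leader-exists x in
      subst (_< cells ρ) (countIn-zero (λ _ → false) (λ _ ()) (allFin n))
        (countIn-strict (λ _ → false) (leader? ρ) (λ _ ()) (allFin n) (∈-allFin m) lead (λ ()))

  -- A strictly finer partition has strictly more cells: the leaders of ρ stay
  -- leaders in σ, and the cell of ρ that σ splits acquires an extra leader.
  cells-strict : ∀ {ρ σ} → IsPartition ρ → IsPartition σ → σ ⊑ ρ →
                 ∀ {u v} → T (ρ u v) → ¬ T (σ u v) → cells ρ < cells σ
  cells-strict {ρ} {σ} Pρ Pσ σ⊑ρ {u} {v} ρuv ¬σuv =
    countIn-strict (leader? ρ) (leader? σ) (λ _ → leader-⊑ {ρ} σ⊑ρ)
      (allFin n) (∈-allFin y) lead-y ¬lead-y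
    where
    open IsPartition renaming (sym to psym; transitive to ptrans)
    m = proj₁ (leader-exists Pρ u)
    ρmu = proj₁ (proj₂ (leader-exists Pρ u))
    lead-m = proj₂ (proj₂ (leader-exists Pρ u))
    split-off : ∃ λ x → T (ρ m x) × ¬ T (σ m x)
    split-off with σ m u in eq
    ... | false = u , ρmu , λ σmu → subst T eq σmu
    ... | true  = v , ptrans Pρ m u v ρmu ρuv ,
                  λ σmv → ¬σuv (ptrans Pσ u m v (psym Pσ m u (subst T (sym eq) tt)) σmv)
    x = proj₁ split-off
    y = proj₁ (leader-exists Pσ x)
    σyx = proj₁ (proj₂ (leader-exists Pσ x))
    lead-y = proj₂ (proj₂ (leader-exists Pσ x))
    ¬lead-y : ¬ T (leader? ρ y)
    ¬lead-y lead = proj₂ (proj₂ split-off) (subst (λ t → T (σ t x)) (sym m≡y) σyx)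
      where
      m≡y : m ≡ y
      m≡y = leader-unique Pρ lead-m lead
              (ptrans Pρ m x y (proj₁ (proj₂ split-off)) (psym Pρ y x (σ⊑ρ σyx)))

module _ {n : ℕ} (G : Graph n) where

  nbrs-cong : ∀ u {X Y} → X ≐ Y → nbrs G u X ≡ nbrs G u Y
  nbrs-cong u X≐Y = countIn-cong _ _ (λ x → cong (adj G u x ∧_) (X≐Y x)) (allFin n)

  nbrs-split : ∀ u X Y → nbrs G u X ≡ nbrs G u (X ∩ Y) + nbrs G u (X ∖ Y)
  nbrs-split u X Y = trans (countIn-split (λ x → adj G u x ∧ X x) Y (allFin n))
    (cong₂ _+_ (countIn-cong _ _ (λ x → ∧-assoc (adj G u x) (X x) (Y x)) (allFin n))
               (countIn-cong _ _ (λ x → ∧-assoc (adj G u x) (X x) (not (Y x))) (allFin n)))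

  Agree : PRel n → VSet n → Fin n → Fin n → Set
  Agree ρ R u v = ∀ w → ρ w ⊆ R → nbrs G u (ρ w) ≡ nbrs G v (ρ w)

  agree-⊆ : ∀ {ρ R R′ u v} → R′ ⊆ R → Agree ρ R u v → Agree ρ R′ u v
  agree-⊆ R′⊆R agree w ρw⊆R′ = agree w (λ x∈ → R′⊆R (ρw⊆R′ x∈))

  stable-agree : ∀ ρ → Stable G ρ → ∀ {u v} → T (ρ u v) → ∀ R → Agree ρ R u v
  stable-agree ρ st {u} {v} r R w _ =
    ≡ᵇ⇒≡ _ _ (allV-sound _ (⇒ᵇ-elim (ρ u v) _ (allV-sound _ (allV-sound _ st u) v) r) w)

  unstable-witness : ∀ ρ → ¬ Stable G ρ →
    ∃ λ u → ∃ λ v → ∃ λ w → T (ρ u v) × ¬ nbrs G u (ρ w) ≡ nbrs G v (ρ w)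
  unstable-witness ρ ¬st with allV-counterexample _ ¬st
  ... | u , hu with allV-counterexample _ hu
  ... | v , hv with ⇒ᵇ-counterexample (ρ u v) _ hv
  ... | r , hw with allV-counterexample _ hw
  ... | w , ≢ = u , v , w , r , λ eq → ≢ (≡⇒≡ᵇ _ _ eq)

  -- Agreement on every cell inside a ρ-closed X yields agreement on X itself,
  -- X being the disjoint union of those cells.  Induction on |X|, removing one cell.
  agree-closed : ∀ {ρ} → IsPartition ρ → ∀ {X u v} → Closed ρ X → Agree ρ X u v →
                 nbrs G u X ≡ nbrs G v X
  agree-closed {ρ} P {X} {u} {v} = go (suc (count X)) X ≤-refl
    where
    open IsPartition P using (reflexive)
    go : ∀ m X → count X < m → Closed ρ X → Agree ρ X u v → nbrs G u X ≡ nbrs G v X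
    go (suc m) X size cX agree with any? (λ x → T? (X x))
    ... | no empty = trans (no-nbrs u) (sym (no-nbrs v))
      where
      no-nbrs : ∀ y → nbrs G y X ≡ 0
      no-nbrs y = countIn-zero _ (λ x h → empty (x , ∩-⊆ʳ {X = adj G y} {Y = X} h)) (allFin n)
    ... | yes (c , Xc) = begin
      nbrs G u X                              ≡⟨ split u ⟩
      nbrs G u (ρ c) + nbrs G u (X ∖ ρ c)     ≡⟨ cong₂ _+_ (agree c ρc⊆X) on-rest ⟩
      nbrs G v (ρ c) + nbrs G v (X ∖ ρ c)     ≡⟨ sym (split v) ⟩
      nbrs G v X                              ∎
      where
      open ≡-Reasoning
      ρc⊆X : ρ c ⊆ X
      ρc⊆X ρcx = subst T (cX ρcx) Xc
      split : ∀ y → nbrs G y X ≡ nbrs G y (ρ c) + nbrs G y (X ∖ ρ c)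
      split y = trans (nbrs-split y X (ρ c)) (cong (_+ nbrs G y (X ∖ ρ c)) (nbrs-cong y (∩-⊇ ρc⊆X)))
      smaller : count (X ∖ ρ c) < count X
      smaller = countIn-strict (X ∖ ρ c) X (λ x → ∖-⊆ˡ {X = X} {Y = ρ c}) (allFin n) (∈-allFin c) Xc
                  (λ h → not-elim (proj₂ (∧-elim {X c} h)) (reflexive c))
      on-rest : nbrs G u (X ∖ ρ c) ≡ nbrs G v (X ∖ ρ c)
      on-rest = go m (X ∖ ρ c) (≤-trans smaller (≤-pred size))
                  (closed-∖ {X = X} {Y = ρ c} cX (cell-closed P c))
                  (agree-⊆ (∖-⊆ˡ {X = X} {Y = ρ c}) agree)

  agree? : PRel n → VSet n → Fin n → Fin n → Bool
  agree? ρ R u v = allV (λ w → not (subset? (ρ w) R) ∨ (nbrs G u (ρ w) ≡ᵇ nbrs G v (ρ w)))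

  agree?-sound : ∀ ρ R u v → T (agree? ρ R u v) → Agree ρ R u v
  agree?-sound ρ R u v h w ρw⊆R =
    ≡ᵇ⇒≡ _ _ (⇒ᵇ-elim (subset? (ρ w) R) _ (allV-sound _ h w) (subset?-complete (ρ w) R ρw⊆R))

  agree?-complete : ∀ ρ R u v → Agree ρ R u v → T (agree? ρ R u v)
  agree?-complete ρ R u v agree = allV-complete _ λ w →
    ⇒ᵇ-intro (subset? (ρ w) R) _ λ sub → ≡⇒≡ᵇ _ _ (agree w (subset?-sound (ρ w) R sub))

  refine-sound : ∀ ρ R S {u v} → T (refine G ρ R S u v) →
                 T (ρ u v) × (T (S u) → T (S v) → Agree ρ R u v)
  refine-sound ρ R S {u} {v} h =
    let r , rest = ∧-elim {ρ u v} h in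
    r , λ su sv → agree?-sound ρ R u v (⇒ᵇ-elim (S u ∧ S v) _ rest (∧-intro su sv))

  refine-complete : ∀ ρ R S {u v} → T (ρ u v) → (T (S u) → T (S v) → Agree ρ R u v) →
                    T (refine G ρ R S u v)
  refine-complete ρ R S {u} {v} r agree = ∧-intro r (⇒ᵇ-intro (S u ∧ S v) _ λ s →
    let su , sv = ∧-elim {S u} s in agree?-complete ρ R u v (agree su sv))

  refine-⊑ : ∀ ρ R S → refine G ρ R S ⊑ ρ
  refine-⊑ ρ R S h = proj₁ (refine-sound ρ R S h)

  ineffective : ∀ ρ R S → ¬ Effective G ρ R S → refine G ρ R S ≈ ρ
  ineffective ρ R S ¬eff u v = beq-sound _ _ (allV-sound _ (allV-sound _ (¬not-elim ¬eff) u) v)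

  effective-witness : ∀ ρ R S → Effective G ρ R S →
    ∃ λ u → ∃ λ v → T (ρ u v) × ¬ T (refine G ρ R S u v)
  effective-witness ρ R S eff with allV-counterexample _ (not-elim eff)
  ... | u , hu with allV-counterexample _ hu
  ... | v , hv with beq-counterexample (refine G ρ R S u v) (ρ u v) hv
  ... | inj₁ (split , ¬r) = ⊥-elim (¬r (refine-⊑ ρ R S split))
  ... | inj₂ (¬split , r) = u , v , r , ¬split

  separated : ∀ {ρ A B u v} → T (ρ u v) → ¬ T (refine G ρ A B u v) →
              T (B u) × ∃ λ w → ρ w ⊆ A × ¬ nbrs G u (ρ w) ≡ nbrs G v (ρ w)
  separated {ρ} {A} {B} {u} {v} r ¬kept with T? (B u) | T? (agree? ρ A u v)
  ... | no ¬Bu | _ = ⊥-elim (¬kept (refine-complete ρ A B r λ Bu _ → ⊥-elim (¬Bu Bu)))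
  ... | yes _ | yes agree = ⊥-elim (¬kept (refine-complete ρ A B r λ _ _ → agree?-sound ρ A u v agree))
  ... | yes Bu | no ¬agree with allV-counterexample _ ¬agree
  ... | w , ¬balanced with ⇒ᵇ-counterexample (subset? (ρ w) A) _ ¬balanced
  ... | ρw⊆A , ≢ = Bu , w , subset?-sound (ρ w) A ρw⊆A , λ eq → ≢ (≡⇒≡ᵇ _ _ eq)

  refine-partition : ∀ {ρ R S} → IsPartition ρ → Closed ρ S → IsPartition (refine G ρ R S)
  refine-partition {ρ} {R} {S} P cS = record
    { reflexive  = λ u → refine-complete ρ R S (reflexive u) (λ _ _ _ _ → refl)
    ; sym        = λ u v h →
        let r , agree = refine-sound ρ R S h in
        refine-complete ρ R S (ρ-sym u v r) (λ sv su w sub → sym (agree su sv w sub))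
    ; transitive = λ u v w h₁ h₂ →
        let r₁ , agree₁ = refine-sound ρ R S h₁
            r₂ , agree₂ = refine-sound ρ R S h₂
        in refine-complete ρ R S (ρ-trans u v w r₁ r₂) λ su sw x sub →
             let sv = subst T (cS r₁) su in trans (agree₁ su sv x sub) (agree₂ sv sw x sub)
    }
    where open IsPartition P renaming (sym to ρ-sym; transitive to ρ-trans)

  refine-agree : ∀ {ρ R S u v} → IsPartition ρ → T (refine G ρ R S u v) → T (S u) → T (S v) →
                 ∀ {Z} → Closed ρ Z → Z ⊆ R → nbrs G u Z ≡ nbrs G v Z
  refine-agree {ρ} {R} {S} P h su sv cZ Z⊆R =
    agree-closed P cZ (agree-⊆ Z⊆R (proj₂ (refine-sound ρ R S h) su sv))

  refine-mono : ∀ {ρ σ} A B → IsPartition ρ → IsPartition σ → ρ ⊑ σ →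
                refine G ρ A B ⊑ refine G σ A B
  refine-mono {ρ} {σ} A B Pρ Pσ ρ⊑σ h = refine-complete σ A B (ρ⊑σ (refine-⊑ ρ A B h))
    λ su sv w σw⊆A → refine-agree Pρ h su sv (closed-⊑ {ρ = σ} ρ⊑σ (cell-closed Pσ w)) σw⊆A

  -- ρ is a partition between π₀ and each stable partition refining π₀.
  -- Refining operations never leave this range.
  record Between (π₀ ρ : PRel n) : Set where
    field
      partition    : IsPartition ρ
      below        : ρ ⊑ π₀
      above-stable : ∀ {τ} → IsPartition τ → Stable G τ → τ ⊑ π₀ → τ ⊑ ρ

  between-refl : ∀ {π₀} → IsPartition π₀ → Between π₀ π₀
  between-refl P = record { partition = P ; below = λ r → r ; above-stable = λ _ _ τ⊑π₀ → τ⊑π₀ }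

  refine-between : ∀ {π₀ ρ} R S → Between π₀ ρ → Closed ρ S → Between π₀ (refine G ρ R S)
  refine-between {π₀} {ρ} R S b cS = record
    { partition    = refine-partition partition cS
    ; below        = λ h → below (refine-⊑ ρ R S h)
    ; above-stable = λ {τ} Pτ st τ⊑π₀ h →
        let τ⊑ρ = above-stable Pτ st τ⊑π₀ in
        refine-complete ρ R S (τ⊑ρ h) λ _ _ w _ →
          agree-closed Pτ (closed-⊑ {ρ = ρ} τ⊑ρ (cell-closed partition w)) (stable-agree τ st h (ρ w))
    }
    where open Between b

  separating-effective : ∀ {ρ} → IsPartition ρ → ∀ {u v w} → T (ρ u v) →
    ¬ nbrs G u (ρ w) ≡ nbrs G v (ρ w) → Effective G ρ (ρ w) (ρ u)
  separating-effective {ρ} P {u} {v} {w} r ≢ = not-intro λ unchanged →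
    let kept = subst T (sym (ineffective ρ (ρ w) (ρ u) (λ eff → not-elim eff unchanged) u v)) r
    in ≢ (proj₂ (refine-sound ρ (ρ w) (ρ u) kept) (reflexive u) r w (λ x∈ → x∈))
    where open IsPartition P using (reflexive)

  effective-cells : ∀ {ρ} R S → IsPartition ρ → Closed ρ S → Effective G ρ R S →
                    cells ρ < cells (refine G ρ R S)
  effective-cells {ρ} R S P cS eff =
    let u , v , r , ¬kept = effective-witness ρ R S eff
    in cells-strict P (refine-partition P cS) (refine-⊑ ρ R S) r ¬kept

  -- Extensionality.  Everything cost is built from depends on partitions and
  -- vertex sets only pointwise; needed because allSubsets lists sets only up to ≐.

  agree?-cong : ∀ {ρ σ R R′} → ρ ≈ σ → R ≐ R′ → ∀ u v → agree? ρ R u v ≡ agree? σ R′ u v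
  agree?-cong ρ≈σ R≐R′ u v = allV-cong _ _ λ w →
    cong₂ (λ a b → not a ∨ b) (subset?-cong (ρ≈σ w) R≐R′)
          (cong₂ _≡ᵇ_ (nbrs-cong u (ρ≈σ w)) (nbrs-cong v (ρ≈σ w)))

  refine-cong : ∀ {ρ σ R R′ S S′} → ρ ≈ σ → R ≐ R′ → S ≐ S′ →
                refine G ρ R S ≈ refine G σ R′ S′
  refine-cong ρ≈σ R≐R′ S≐S′ u v = cong₂ _∧_ (ρ≈σ u v)
    (cong₂ _∨_ (cong not (cong₂ _∧_ (S≐S′ u) (S≐S′ v))) (agree?-cong ρ≈σ R≐R′ u v))

  effective?-cong : ∀ {ρ σ R R′ S S′} → ρ ≈ σ → R ≐ R′ → S ≐ S′ →
                    effective? G ρ R S ≡ effective? G σ R′ S′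
  effective?-cong ρ≈σ R≐R′ S≐S′ = cong not (allV-cong _ _ λ u → allV-cong _ _ λ v →
    cong₂ beq (refine-cong ρ≈σ R≐R′ S≐S′ u v) (ρ≈σ u v))

  stable?-cong : ∀ {ρ σ} → ρ ≈ σ → stable? G ρ ≡ stable? G σ
  stable?-cong ρ≈σ = allV-cong _ _ λ u → allV-cong _ _ λ v →
    cong₂ (λ a b → not a ∨ b) (ρ≈σ u v) (allV-cong _ _ λ w →
      cong₂ _≡ᵇ_ (nbrs-cong u (ρ≈σ w)) (nbrs-cong v (ρ≈σ w)))

  opCost-cong : ∀ {R R′ S S′} → R ≐ R′ → S ≐ S′ → opCost G R S ≡ opCost G R′ S′
  opCost-cong R≐R′ S≐S′ = sumIn-cong _ _ (λ u → countIn-cong _ _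
    (λ v → cong₂ (λ a b → adj G u v ∧ a ∧ b) (R≐R′ u) (S≐S′ v)) (allFin n)) (allFin n)

  Admissible : PRel n → VSet n → VSet n → Set
  Admissible ρ R S = Closed ρ R × Closed ρ S × Effective G ρ R S

  admissible? : PRel n → VSet n → VSet n → Bool
  admissible? ρ R S = closed? ρ R ∧ closed? ρ S ∧ effective? G ρ R S

  admissible?-sound : ∀ ρ R S → T (admissible? ρ R S) → Admissible ρ R S
  admissible?-sound ρ R S h =
    let cR , rest = ∧-elim {closed? ρ R} h
        cS , eff  = ∧-elim {closed? ρ S} rest
    in closed?-sound ρ R cR , closed?-sound ρ S cS , eff

  admissible?-complete : ∀ ρ R S → Admissible ρ R S → T (admissible? ρ R S)
  admissible?-complete ρ R S (cR , cS , eff) =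
    ∧-intro (closed?-complete ρ R cR) (∧-intro (closed?-complete ρ S cS) eff)

  admissible?-cong : ∀ {ρ σ R R′ S S′} → ρ ≈ σ → R ≐ R′ → S ≐ S′ →
                     admissible? ρ R S ≡ admissible? σ R′ S′
  admissible?-cong ρ≈σ R≐R′ S≐S′ = cong₂ _∧_ (closed?-cong ρ≈σ R≐R′)
    (cong₂ _∧_ (closed?-cong ρ≈σ S≐S′) (effective?-cong ρ≈σ R≐R′ S≐S′))

  candidate : ℕ → PRel n → VSet n → VSet n → List ℕ
  candidate k ρ R S =
    if admissible? ρ R S then [ costF G k (refine G ρ R S) + opCost G R S ] else []

  -- By definition,  costF G (suc k) ρ = if stable? G ρ then 0 else minL (candidates k ρ).
  row : ℕ → PRel n → VSet n → List ℕ
  row k ρ R = concatMap (candidate k ρ R) (allSubsets n)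

  candidates : ℕ → PRel n → List ℕ
  candidates k ρ = concatMap (row k ρ) (allSubsets n)

  candidates-cong : ∀ {k k′ ρ σ} → ρ ≈ σ →
    (∀ R S → Admissible ρ R S → costF G k (refine G ρ R S) ≡ costF G k′ (refine G σ R S)) →
    candidates k ρ ≡ candidates k′ σ
  candidates-cong {k} {k′} {ρ} {σ} ρ≈σ same =
    concatMap-cong {f = row k ρ} {g = row k′ σ}
      (λ R → concatMap-cong (entry R) (allSubsets n)) (allSubsets n)
    where
    entry : ∀ R S → candidate k ρ R S ≡ candidate k′ σ R S
    entry R S = singleton-if-cong (admissible?-cong {R = R} {S = S} ρ≈σ (λ _ → refl) (λ _ → refl))
      λ adm → cong (_+ opCost G R S) (same R S (admissible?-sound ρ R S adm))

  costF-cong : ∀ k {ρ σ} → ρ ≈ σ → costF G k ρ ≡ costF G k σ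
  costF-cong zero    ρ≈σ = refl
  costF-cong (suc k) ρ≈σ = cong₂ (λ b m → if b then 0 else m) (stable?-cong ρ≈σ)
    (cong minL (candidates-cong {k} {k} ρ≈σ λ R S _ →
      costF-cong k (refine-cong {R = R} {S = S} ρ≈σ (λ _ → refl) (λ _ → refl))))

  candidate-∈ : ∀ k ρ R S → Admissible ρ R S →
                costF G k (refine G ρ R S) + opCost G R S ∈ candidates k ρ
  candidate-∈ k ρ R S adm
    with find (allSubsets-complete n R) | find (allSubsets-complete n S)
  ... | R′ , R′∈ , R′≐R | S′ , S′∈ , S′≐S =
    subst (_∈ candidates k ρ) same-value
      (∈-concatMap⁺ (row k ρ) {xs = allSubsets n} (lose R′∈
        (∈-concatMap⁺ (candidate k ρ R′) {xs = allSubsets n} (lose S′∈ listed))))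
    where
    listed : costF G k (refine G ρ R′ S′) + opCost G R′ S′ ∈ candidate k ρ R′ S′
    listed = singleton-if-∈
      (subst T (sym (admissible?-cong {ρ = ρ} (λ _ _ → refl) R′≐R S′≐S))
               (admissible?-complete ρ R S adm))
    same-value : costF G k (refine G ρ R′ S′) + opCost G R′ S′
               ≡ costF G k (refine G ρ R S) + opCost G R S
    same-value = cong₂ _+_ (costF-cong k (refine-cong {ρ = ρ} (λ _ _ → refl) R′≐R S′≐S))
                           (opCost-cong R′≐R S′≐S)

  candidate-∈⁻ : ∀ k ρ {y} → y ∈ candidates k ρ →
    ∃ λ R → ∃ λ S → Admissible ρ R S × y ≡ costF G k (refine G ρ R S) + opCost G R S
  candidate-∈⁻ k ρ {y} y∈ with find (∈-concatMap⁻ (row k ρ) {xs = allSubsets n} y∈)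
  ... | R , _ , y∈R with find (∈-concatMap⁻ (candidate k ρ R) {xs = allSubsets n} y∈R)
  ... | S , _ , y∈RS = R , S , listed y∈RS
    where
    listed : y ∈ candidate k ρ R S →
             Admissible ρ R S × y ≡ costF G k (refine G ρ R S) + opCost G R S
    listed y∈ with admissible? ρ R S in eq
    listed (here y≡) | true = admissible?-sound ρ R S (subst T (sym eq) tt) , y≡

  costF-≤ : ∀ k ρ R S → Admissible ρ R S →
            costF G (suc k) ρ ≤ costF G k (refine G ρ R S) + opCost G R S
  costF-≤ k ρ R S adm with stable? G ρ
  ... | true  = z≤n
  ... | false = minL-≤ _ (candidate-∈ k ρ R S adm)

  costF-attained : ∀ k ρ → ¬ Stable G ρ → ∀ {R S} → Admissible ρ R S →
    ∃ λ R′ → ∃ λ S′ → Admissible ρ R′ S′ ×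
      costF G (suc k) ρ ≡ costF G k (refine G ρ R′ S′) + opCost G R′ S′
  costF-attained k ρ ¬st adm with stable? G ρ
  ... | true  = ⊥-elim (¬st tt)
  ... | false = candidate-∈⁻ k ρ (minL-∈ _ (candidate-∈ k ρ _ _ adm))

  spend-fuel : ∀ m {c c′} → suc n ≤ suc m + c → c < c′ → suc n ≤ m + c′
  spend-fuel m {c} {c′} enough c<c′ =
    ≤-trans enough (subst (_≤ m + c′) (+-suc m c) (+-monoʳ-≤ m c<c′))

  -- Once k + cells ρ > n, more fuel does not change costF: every chain of
  -- effective operations starting at ρ has fewer than k steps.
  costF-fuel : ∀ k ρ → IsPartition ρ → suc n ≤ k + cells ρ → costF G k ρ ≡ costF G (suc k) ρ
  costF-fuel zero    ρ P enough = ⊥-elim (<⇒≱ enough (cells-≤ ρ))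
  costF-fuel (suc k) ρ P enough = cong (λ c → if stable? G ρ then 0 else minL c)
    (candidates-cong {k} {suc k} (λ _ _ → refl) λ R S (_ , cS , eff) →
      costF-fuel k (refine G ρ R S) (refine-partition P cS)
        (spend-fuel k enough (effective-cells R S P cS eff)))

  -- On a nonempty vertex set the fuel n left after one step is already enough.
  cost-fuel : Fin n → ∀ {ρ} → IsPartition ρ → costF G n ρ ≡ cost G ρ
  cost-fuel x {ρ} P = costF-fuel n ρ P (subst (_≤ n + cells ρ) (+-comm n 1) (+-monoʳ-≤ n (cells-pos P x)))

  cost-≤ : Fin n → ∀ {ρ R S} → IsPartition ρ → Closed ρ R → Closed ρ S →
           cost G ρ ≤ cost G (refine G ρ R S) + opCost G R S
  cost-≤ x {ρ} {R} {S} P cR cS with T? (effective? G ρ R S)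
  ... | yes eff = subst (λ c → cost G ρ ≤ c + opCost G R S) (cost-fuel x (refine-partition P cS))
                        (costF-≤ n ρ R S (cR , cS , eff))
  ... | no ¬eff = ≤-trans (≤-reflexive (costF-cong (suc n) λ u v → sym (ineffective ρ R S ¬eff u v)))
                          (m≤m+n _ _)

  OptimalStep : PRel n → Set
  OptimalStep ρ =
    ∃ λ R → ∃ λ S → Admissible ρ R S × cost G ρ ≡ cost G (refine G ρ R S) + opCost G R S

  cost-attained : ∀ {ρ} → IsPartition ρ → ¬ Stable G ρ → OptimalStep ρ
  cost-attained {ρ} P ¬st with unstable-witness ρ ¬st
  ... | u , v , w , r , ≢ with costF-attained n ρ ¬st
        {ρ w} {ρ u} (cell-closed P w , cell-closed P u , separating-effective P r ≢)
  ... | R , S , adm@(_ , cS , _) , eq =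
        R , S , adm , trans eq (cong (_+ opCost G R S) (cost-fuel u (refine-partition P cS)))

  -- Induction on the number of steps σ is away from stability: the optimal first
  -- operation (A,B) for σ, applied to ρ, leads to a partition finer than σ(A,B).
  cost-mono : Fin n → ∀ {π₀ ρ σ} → Between π₀ ρ → Between π₀ σ → ρ ⊑ σ →
              cost G ρ ≤ cost G σ
  cost-mono x {π₀} {σ = σ} bρ bσ ρ⊑σ = go (suc n) bρ bσ ρ⊑σ (m≤m+n (suc n) (cells σ))
    where
    open Between
    go : ∀ m {ρ σ} → Between π₀ ρ → Between π₀ σ → ρ ⊑ σ → suc n ≤ m + cells σ →
         cost G ρ ≤ cost G σ
    go zero {σ = σ} _ _ _ enough = ⊥-elim (<⇒≱ enough (cells-≤ σ))
    go (suc m) {ρ} {σ} bρ bσ ρ⊑σ enough = by-stability (T? (stable? G σ))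
      where
      by-stability : Dec (Stable G σ) → cost G ρ ≤ cost G σ
      by-stability (yes st) = ≤-reflexive (costF-cong (suc n) {ρ} {σ} λ u v →
        T-ext ρ⊑σ (above-stable bρ (partition bσ) st (below bσ)))
      by-stability (no ¬st) = through (cost-attained (partition bσ) ¬st)
        where
        through : OptimalStep σ → cost G ρ ≤ cost G σ
        through (A , B , (cA , cB , eff) , σ-cost) = begin
          cost G ρ                                  ≤⟨ cost-≤ x (partition bρ) cAρ cBρ ⟩
          cost G (refine G ρ A B) + opCost G A B    ≤⟨ +-monoˡ-≤ (opCost G A B) finer ⟩
          cost G (refine G σ A B) + opCost G A B    ≡⟨ sym σ-cost ⟩
          cost G σ                                  ∎
          where
          open ≤-Reasoning
          cAρ : Closed ρ A
          cAρ = closed-⊑ {ρ = σ} ρ⊑σ cA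
          cBρ : Closed ρ B
          cBρ = closed-⊑ {ρ = σ} ρ⊑σ cB
          finer : cost G (refine G ρ A B) ≤ cost G (refine G σ A B)
          finer = go m (refine-between A B bρ cBρ) (refine-between A B bσ cB)
                       (refine-mono A B (partition bρ) (partition bσ) ρ⊑σ)
                       (spend-fuel m enough (effective-cells A B (partition bσ) cB eff))

  opCost-nbrs : ∀ R S → opCost G R S ≡ sumIn (λ u → if R u then nbrs G u S else 0) (allFin n)
  opCost-nbrs R S = sumIn-cong _ _ per-vertex (allFin n)
    where
    per-vertex : ∀ u → count (λ v → adj G u v ∧ R u ∧ S v) ≡ (if R u then nbrs G u S else 0)
    per-vertex u with R u
    ... | true  = refl
    ... | false = countIn-zero _ (λ v h → proj₂ (∧-elim {adj G u v} h)) (allFin n)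

  opCost-splitˡ : ∀ {R X} S → X ⊆ R → opCost G R S ≡ opCost G X S + opCost G (R ∖ X) S
  opCost-splitˡ {R} {X} S X⊆R = begin
    opCost G R S                                 ≡⟨ opCost-nbrs R S ⟩
    sumIn (λ u → on R u) (allFin n)              ≡⟨ sumIn-cong _ _ per-vertex (allFin n) ⟩
    sumIn (λ u → on X u + on (R ∖ X) u) (allFin n) ≡⟨ sumIn-+ (on X) (on (R ∖ X)) (allFin n) ⟩
    sumIn (on X) (allFin n) + sumIn (on (R ∖ X)) (allFin n)
      ≡⟨ sym (cong₂ _+_ (opCost-nbrs X S) (opCost-nbrs (R ∖ X) S)) ⟩
    opCost G X S + opCost G (R ∖ X) S            ∎
    where
    open ≡-Reasoning
    on : VSet n → Fin n → ℕ
    on Y u = if Y u then nbrs G u S else 0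
    per-vertex : ∀ u → on R u ≡ on X u + on (R ∖ X) u
    per-vertex u with X u in eqX | R u in eqR
    ... | true  | true  = sym (+-identityʳ _)
    ... | true  | false = ⊥-elim (subst T eqR (X⊆R (subst T (sym eqX) tt)))
    ... | false | true  = refl
    ... | false | false = refl

  opCost-splitʳ : ∀ R {S X} → X ⊆ S → opCost G R S ≡ opCost G R X + opCost G R (S ∖ X)
  opCost-splitʳ R {S} {X} X⊆S = begin
    opCost G R S                                 ≡⟨ opCost-nbrs R S ⟩
    sumIn (on S) (allFin n)                      ≡⟨ sumIn-cong _ _ per-vertex (allFin n) ⟩
    sumIn (λ u → on X u + on (S ∖ X) u) (allFin n) ≡⟨ sumIn-+ (on X) (on (S ∖ X)) (allFin n) ⟩
    sumIn (on X) (allFin n) + sumIn (on (S ∖ X)) (allFin n)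
      ≡⟨ sym (cong₂ _+_ (opCost-nbrs R X) (opCost-nbrs R (S ∖ X))) ⟩
    opCost G R X + opCost G R (S ∖ X)            ∎
    where
    open ≡-Reasoning
    on : VSet n → Fin n → ℕ
    on Y u = if R u then nbrs G u Y else 0
    per-vertex : ∀ u → on S u ≡ on X u + on (S ∖ X) u
    per-vertex u with R u
    ... | true  = trans (nbrs-split u S X) (cong (_+ nbrs G u (S ∖ X)) (nbrs-cong u (∩-⊇ X⊆S)))
    ... | false = refl

  module ThreeSteps {π : PRel n} (P : IsPartition π) (A B R S : VSet n)
                    (cA : Closed π A) (cB : Closed π B) (cR : Closed π R) (cS : Closed π S) where

    ρ₁ ρ₂ ρ₃ : PRel n
    ρ₁ = refine G π R S
    ρ₂ = refine G ρ₁ R (B ∖ S)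
    ρ₃ = refine G ρ₂ (A ∖ R) B

    ρ₂⊑π : ρ₂ ⊑ π
    ρ₂⊑π h = refine-⊑ π R S (refine-⊑ ρ₁ R (B ∖ S) h)

    P₁ : IsPartition ρ₁
    P₁ = refine-partition P cS
    P₂ : IsPartition ρ₂
    P₂ = refine-partition P₁ (closed-⊑ {ρ = π} (refine-⊑ π R S) (closed-∖ {X = B} {Y = S} cB cS))

    -- A cell C ⊆ A
    -- splits as (C ∩ R) ∪ (C ∖ R); the first part is handled by step 1 or 2
    -- (as the vertices lie in S or in B ∖ S), the second by step 3.
    part-closed : ∀ w → Closed π (π w ∩ R)
    part-closed w = closed-∩ {X = π w} {Y = R} (cell-closed P w) cR

    finer : ρ₃ ⊑ refine G π A B
    finer {a} {b} h₃ = refine-complete π A B h₀ λ Ba Bb w πw⊆A → begin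
      nbrs G a (π w)                            ≡⟨ nbrs-split a (π w) R ⟩
      nbrs G a (π w ∩ R) + nbrs G a (π w ∖ R)
        ≡⟨ cong₂ _+_ (inside-R w Ba Bb) (outside-R w Ba Bb πw⊆A) ⟩
      nbrs G b (π w ∩ R) + nbrs G b (π w ∖ R)   ≡⟨ sym (nbrs-split b (π w) R) ⟩
      nbrs G b (π w)                            ∎
      where
      open ≡-Reasoning
      h₂ = refine-⊑ ρ₂ (A ∖ R) B h₃
      h₁ = refine-⊑ ρ₁ R (B ∖ S) h₂
      h₀ = refine-⊑ π R S h₁
      inside-R : ∀ w → T (B a) → T (B b) → nbrs G a (π w ∩ R) ≡ nbrs G b (π w ∩ R)
      inside-R w Ba Bb with T? (S a)
      ... | yes Sa = refine-agree P h₁ Sa (subst T (cS h₀) Sa) (part-closed w) (∩-⊆ʳ {X = π w} {Y = R})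
      ... | no ¬Sa = refine-agree P₁ h₂ (∧-intro Ba (not-intro ¬Sa))
                       (∧-intro Bb (not-intro λ Sb → ¬Sa (subst T (sym (cS h₀)) Sb)))
                       (closed-⊑ {ρ = π} (refine-⊑ π R S) (part-closed w)) (∩-⊆ʳ {X = π w} {Y = R})
      outside-R : ∀ w → T (B a) → T (B b) → π w ⊆ A → nbrs G a (π w ∖ R) ≡ nbrs G b (π w ∖ R)
      outside-R w Ba Bb πw⊆A = refine-agree P₂ h₃ Ba Bb
        (closed-⊑ {ρ = π} ρ₂⊑π (closed-∖ {X = π w} {Y = R} (cell-closed P w) cR))
        (λ {x} h → let πwx , ¬Rx = ∧-elim {π w x} h in ∧-intro (πw⊆A πwx) ¬Rx)

    between₃ : Between π ρ₃
    between₃ = refine-between (A ∖ R) B between₂ (closed-⊑ {ρ = π} ρ₂⊑π cB)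
      where
      between₂ = refine-between R (B ∖ S) (refine-between R S (between-refl P) cS)
                   (closed-⊑ {ρ = π} (refine-⊑ π R S) (closed-∖ {X = B} {Y = S} cB cS))

    cheaper : Fin n → R ⊆ A → S ⊆ B →
              cost G ρ₁ + opCost G R S ≤ cost G (refine G π A B) + opCost G A B
    cheaper x R⊆A S⊆B = begin
      cost G ρ₁ + c₁                   ≤⟨ +-monoˡ-≤ c₁ step₂ ⟩
      cost G ρ₂ + c₂ + c₁              ≤⟨ +-monoˡ-≤ c₁ (+-monoˡ-≤ c₂ step₃) ⟩
      cost G ρ₃ + c₃ + c₂ + c₁
        ≤⟨ +-monoˡ-≤ c₁ (+-monoˡ-≤ c₂ (+-monoˡ-≤ c₃ after)) ⟩
      cost G σ + c₃ + c₂ + c₁          ≡⟨ regroup (cost G σ) c₁ c₂ c₃ ⟩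
      cost G σ + (c₁ + c₂ + c₃)        ≡⟨ cong (cost G σ +_) (sym split) ⟩
      cost G σ + opCost G A B          ∎
      where
      open ≤-Reasoning
      σ = refine G π A B
      c₁ = opCost G R S
      c₂ = opCost G R (B ∖ S)
      c₃ = opCost G (A ∖ R) B
      regroup : ∀ s a b c → s + c + b + a ≡ s + (a + b + c)
      regroup = solve-∀
      split : opCost G A B ≡ c₁ + c₂ + c₃
      split = trans (opCost-splitˡ B R⊆A) (cong (_+ c₃) (opCost-splitʳ R S⊆B))
      step₂ : cost G ρ₁ ≤ cost G ρ₂ + c₂
      step₂ = cost-≤ x P₁ (closed-⊑ {ρ = π} (refine-⊑ π R S) cR)
                          (closed-⊑ {ρ = π} (refine-⊑ π R S) (closed-∖ {X = B} {Y = S} cB cS))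
      step₃ : cost G ρ₂ ≤ cost G ρ₃ + c₃
      step₃ = cost-≤ x P₂ (closed-⊑ {ρ = π} ρ₂⊑π (closed-∖ {X = A} {Y = R} cA cR))
                          (closed-⊑ {ρ = π} ρ₂⊑π cB)
      after : cost G ρ₃ ≤ cost G σ
      after = cost-mono x between₃ (refine-between A B (between-refl P) cB) finer

  -- An optimal operation can be traded for an elementary effective one that is no
  -- worse: a cell R ⊆ A separating two vertices of a cell S ⊆ B.
  elementary-no-worse : ∀ {π} → IsPartition π → OptimalStep π →
    ∃ λ R → ∃ λ S → Elementary π R S × Effective G π R S ×
      cost G (refine G π R S) + opCost G R S ≤ cost G π
  elementary-no-worse {π} P (A , B , (cA , cB , eff) , optimal) =
    let u , v , r , ¬kept = effective-witness π A B eff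
        Bu , w , πw⊆A , ≢ = separated {π} {A} {B} r ¬kept
        πu⊆B : π u ⊆ B
        πu⊆B πux = subst T (cB πux) Bu
    in π w , π u , ∧-intro (cell-isCell? π w) (cell-isCell? π u) , separating-effective P r ≢ ,
       subst (cost G (refine G π (π w) (π u)) + opCost G (π w) (π u) ≤_) (sym optimal)
         (ThreeSteps.cheaper P A B (π w) (π u) cA cB (cell-closed P w) (cell-closed P u)
                             u πw⊆A πu⊆B)

proposition7 : ∀ {n : ℕ} (G : Graph n) (π : PRel n) → IsPartition π → ¬ Stable G π →
    Σ (VSet n) (λ R → Σ (VSet n) (λ S →
        Elementary π R S × Effective G π R S ×
        cost G π ≡ cost G (refine G π R S) + opCost G R S))
    × (∀ (R S : VSet n) → Elementary π R S → Effective G π R S →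
        cost G π ≤ cost G (refine G π R S) + opCost G R S)
proposition7 G π P ¬st = attained (elementary-no-worse G P (cost-attained G P ¬st)) , bound
  where
  -- every elementary operation bounds cost(π) from above (π unstable, so V ≠ ∅)
  bound : ∀ R S → Elementary π R S → Effective G π R S →
          cost G π ≤ cost G (refine G π R S) + opCost G R S
  bound R S el _ = let isR , isS = ∧-elim {isCell? π R} el in
    cost-≤ G (proj₁ (unstable-witness G π ¬st)) P
      (isCell?-closed P R isR) (isCell?-closed P S isS)
  attained : (∃ λ R → ∃ λ S → Elementary π R S × Effective G π R S ×
                cost G (refine G π R S) + opCost G R S ≤ cost G π) →
             Σ (VSet _) λ R → Σ (VSet _) λ S → Elementary π R S × Effective G π R S ×
               cost G π ≡ cost G (refine G π R S) + opCost G R S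
  attained (R , S , el , eff , no-worse) = R , S , el , eff , ≤-antisym (bound R S el eff) no-worse
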